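{- Let $n,k$ be positive integers with $n \geq 3(n-k)$ and $n \geq k$, and let $C$ be a linear chord diagram with $n$ chords in which every chord has length at least $k$. Let $M_{n,k}=\{k+1,k+2,\dots,2n-k\}$. Then there is no chord $c$ of $C$ with both $s_c \in M_{n,k}$ and $e_c \in M_{n,k}$.
   Context: A linear chord diagram with $n$ chords is a partition of $\{1,2,\dots,2n\}$ into blocks of size two, called chords. For a chord $c=\{s_c,e_c\}$ with $s_c<e_c$, $s_c$ is its start point, $e_c$ its end point, and its length is $e_c-s_c$. -}

module Defs where

open import Data.Nat using (ℕ; _+_; _*_; _∸_; _≤_; _<_)
open import Data.Fin using (Fin; toℕ)
open import Data.Product using (_×_)
open import Relation.Binary.PropositionalEquality using (_≡_; _≢_)

-- Points 1,...,2n are represented by Fin (2 * n): the element i stands for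
-- the point toℕ i + 1.  A linear chord diagram with n chords (a partition of
-- the points into blocks of size two) is given by its fixed-point-free
-- involution `partner`: the block of i is {i, partner i}.
record ChordDiagram (n : ℕ) : Set where
  field
    partner     : Fin (2 * n) → Fin (2 * n)
    involutive  : ∀ i → partner (partner i) ≡ i
    fixpt-free  : ∀ i → partner i ≢ i

open ChordDiagram public

pos : ∀ {n} → Fin (2 * n) → ℕ
pos {n} i = toℕ i + 1

-- A chord, identified by its start point s (i.e. pos s < pos (partner s)).
IsStart : ∀ {n} → ChordDiagram n → Fin (2 * n) → Set
IsStart {n} C s = pos {n} s < pos {n} (partner C s)

startPt endPt : ∀ {n} (C : ChordDiagram n) → Fin (2 * n) → ℕ
startPt {n} C s = pos {n} s
endPt {n} C s = pos {n} (partner C s)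

chordLength : ∀ {n} (C : ChordDiagram n) → Fin (2 * n) → ℕ
chordLength C s = endPt C s ∸ startPt C s

AllChordsLengthAtLeast : ∀ {n} → ℕ → ChordDiagram n → Set
AllChordsLengthAtLeast k C = ∀ s → IsStart C s → k ≤ chordLength C s

InM : ℕ → ℕ → ℕ → Set
InM n k x = (k + 1 ≤ x) × (x ≤ 2 * n ∸ k)

module Submission where

-- A chord c = {s, e} with s < e and length e - s ≥ k ends at
-- e ≥ s + k.  If s ∈ M_{n,k} then s ≥ k + 1, hence e ≥ 2k + 1.  On the other
-- hand the hypotheses k ≤ n and 3(n - k) ≤ n say that the window M_{n,k} is
-- narrow: writing n = d + k they give 2d ≤ k, so its last point
-- 2n - k = 2d + k is at most 2k.  Thus e ∉ M_{n,k}.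

open import Defs
open import Data.Nat using (ℕ; _+_; _*_; _∸_; _≤_; _<_)
open import Data.Fin using (Fin)
open import Data.Product using (_×_; _,_)
open import Relation.Nullary using (¬_)
open import Data.Nat.Properties
open import Relation.Binary.PropositionalEquality using (_≡_; refl; sym; cong; subst)
open import Data.Nat.Tactic.RingSolver using (solve-∀)

end-from-length : ∀ {k s e} → s < e → k ≤ e ∸ s → s + k ≤ e
end-from-length {k} {s} {e} s<e k≤e∸s = begin
  s + k        ≤⟨ +-monoʳ-≤ s k≤e∸s ⟩
  s + (e ∸ s)  ≡⟨ m+[n∸m]≡n (<⇒≤ s<e) ⟩
  e            ∎
  where open ≤-Reasoning

narrow-window-offset : ∀ d k → 3 * d ≤ d + k → 2 * (d + k) ∸ k ≤ 2 * k
narrow-window-offset d k 3d≤d+k = begin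
  2 * (d + k) ∸ k      ≡⟨ cong (_∸ k) (double-sum d k) ⟩
  (2 * d + k) + k ∸ k  ≡⟨ m+n∸n≡m (2 * d + k) k ⟩
  2 * d + k            ≤⟨ +-monoˡ-≤ k 2d≤k ⟩
  k + k                ≡⟨ sym (double k) ⟩
  2 * k                ∎
  where
  open ≤-Reasoning
  double-sum : ∀ d k → 2 * (d + k) ≡ (2 * d + k) + k
  double-sum = solve-∀
  triple : ∀ d → 3 * d ≡ d + 2 * d
  triple = solve-∀
  double : ∀ k → 2 * k ≡ k + k
  double = solve-∀
  2d≤k : 2 * d ≤ k
  2d≤k = +-cancelˡ-≤ d (2 * d) k (≤-trans (≤-reflexive (sym (triple d))) 3d≤d+k)

narrow-window : ∀ {n k} → 3 * (n ∸ k) ≤ n → k ≤ n → 2 * n ∸ k ≤ 2 * k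
narrow-window {n} {k} 3d≤n k≤n =
  subst (λ m → 2 * m ∸ k ≤ 2 * k) d+k≡n
    (narrow-window-offset (n ∸ k) k (subst (3 * (n ∸ k) ≤_) (sym d+k≡n) 3d≤n))
  where
  d+k≡n : n ∸ k + k ≡ n
  d+k≡n = m∸n+n≡m k≤n

lemma1 : (n k : ℕ) → 1 ≤ n → 1 ≤ k → 3 * (n ∸ k) ≤ n → k ≤ n →
    (C : ChordDiagram n) → AllChordsLengthAtLeast k C →
    (s : Fin (2 * n)) → IsStart C s →
    ¬ (InM n k (startPt C s) × InM n k (endPt C s))
lemma1 n k _ _ 3d≤n k≤n C long s s-starts ((k+1≤s , _) , (_ , e≤2n∸k)) =
  <-irrefl refl (begin-strict
    2 * k                  <⟨ n<1+n (2 * k) ⟩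
    1 + 2 * k              ≡⟨ succ-double k ⟩
    k + 1 + k              ≤⟨ +-monoˡ-≤ k k+1≤s ⟩
    startPt C s + k        ≤⟨ end-from-length s-starts (long s s-starts) ⟩
    endPt C s              ≤⟨ e≤2n∸k ⟩
    2 * n ∸ k              ≤⟨ narrow-window 3d≤n k≤n ⟩
    2 * k                  ∎)
  where
  open ≤-Reasoning
  succ-double : ∀ k → 1 + 2 * k ≡ k + 1 + k
  succ-double = solve-∀
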